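{- Let $G$ and $H$ be graphs such that $G$ is $(k_G,t_G)$-star colorable and $t_G\geq \chi(H)$. Then $\chi'_s(G\square H)\leq k_G+\chi'_s(H)$.
   Context: All graphs are finite, simple and undirected. A star edge coloring of a graph $G$ is a proper edge coloring such that no path or cycle with four edges in $G$ uses at most two colors; $\chi'_s(G)$ is the minimum number of colors in a star edge coloring of $G$, and $\chi(H)$ is the chromatic number. For an edge coloring $f$ and a vertex $v$, $A_f(v)$ denotes the set of colors of the edges incident to $v$. Two star edge colorings $f_1,f_2$ of $G$ are star compatible if $A_{f_1}(v)\cap A_{f_2}(v)=\emptyset$ for every vertex $v$. $G$ is $(k,t)$-star colorable if $G$ has $t$ pairwise star compatible star edge colorings $f_i:E(G)\to\{0,1,\ldots,k-1\}$, $1\le i\le t$. The Cartesian product $G\square H$ has vertex set $V(G)\times V(H)$, with $(a,x)(b,y)$ an edge iff either $ab\in E(G)$ and $x=y$, or $xy\in E(H)$ and $a=b$. -}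

module Defs where

open import Data.Nat using (ℕ; _+_; _*_; _≤_)
open import Data.Fin using (Fin; remQuot)
open import Data.Product using (Σ; ∃; _×_; _,_; proj₁; proj₂)
open import Data.Sum using (_⊎_; inj₁; inj₂)
open import Data.Empty using (⊥)
open import Relation.Nullary using (¬_)
open import Relation.Binary.PropositionalEquality using (_≡_; _≢_; refl; sym)

record Graph : Set₁ where
  field
    n      : ℕ
    Adj    : Fin n → Fin n → Set
    symAdj : ∀ {u v} → Adj u v → Adj v u
    irrefl : ∀ {u} → ¬ Adj u u
open Graph public

-- An edge colouring of G with colours {0,…,k-1}: a colour c u v for each
-- ordered pair, required to be symmetric on edges (only values on edges matter).
record EdgeColoring (G : Graph) (k : ℕ) : Set where
  field
    col    : Fin (n G) → Fin (n G) → Fin k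
    colSym : ∀ {u v} → Adj G u v → col u v ≡ col v u
open EdgeColoring public

Proper : (G : Graph) {k : ℕ} → EdgeColoring G k → Set
Proper G f = ∀ {u v w} → Adj G u v → Adj G u w → v ≢ w → col f u v ≢ col f u w

-- no path or cycle with four edges v0 v1 v2 v3 v4 uses at most two colours.
-- Path: all five vertices distinct; cycle: v4 ≡ v0 and v0..v3 distinct.
NoBicoloredP4C4 : (G : Graph) {k : ℕ} → EdgeColoring G k → Set
NoBicoloredP4C4 G {k} f =
  ∀ (v0 v1 v2 v3 v4 : Fin (n G)) →
  v0 ≢ v1 → v0 ≢ v2 → v0 ≢ v3 → v1 ≢ v2 → v1 ≢ v3 → v2 ≢ v3 →
  v4 ≢ v1 → v4 ≢ v2 → v4 ≢ v3 →
  Adj G v0 v1 → Adj G v1 v2 → Adj G v2 v3 → Adj G v3 v4 →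
  ¬ (Σ (Fin k) λ a → Σ (Fin k) λ b →
       (col f v0 v1 ≡ a ⊎ col f v0 v1 ≡ b) ×
       (col f v1 v2 ≡ a ⊎ col f v1 v2 ≡ b) ×
       (col f v2 v3 ≡ a ⊎ col f v2 v3 ≡ b) ×
       (col f v3 v4 ≡ a ⊎ col f v3 v4 ≡ b))

IsStarEdgeColoring : (G : Graph) {k : ℕ} → EdgeColoring G k → Set
IsStarEdgeColoring G f = Proper G f × NoBicoloredP4C4 G f

StarEdgeColorable : Graph → ℕ → Set
StarEdgeColorable G k = Σ (EdgeColoring G k) λ f → IsStarEdgeColoring G f

IsStarChromaticIndex : Graph → ℕ → Set
IsStarChromaticIndex G s = StarEdgeColorable G s × (∀ m → StarEdgeColorable G m → s ≤ m)

VertexColorable : Graph → ℕ → Set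
VertexColorable G k = Σ (Fin (n G) → Fin k) λ c → ∀ {u v} → Adj G u v → c u ≢ c v

IsChromaticNumber : Graph → ℕ → Set
IsChromaticNumber G s = VertexColorable G s × (∀ m → VertexColorable G m → s ≤ m)

StarCompatible : (G : Graph) {k : ℕ} → EdgeColoring G k → EdgeColoring G k → Set
StarCompatible G f g =
  ∀ (v u w : Fin (n G)) → Adj G v u → Adj G v w → col f v u ≢ col g v w

KTStarColorable : Graph → ℕ → ℕ → Set
KTStarColorable G k t =
  Σ (Fin t → EdgeColoring G k) λ f →
    (∀ i → IsStarEdgeColoring G (f i)) ×
    (∀ i j → i ≢ j → StarCompatible G (f i) (f j))

private
  module _ (G H : Graph) where
    PAdj : Fin (n G * n H) → Fin (n G * n H) → Set
    PAdj p q with remQuot {n G} (n H) p | remQuot {n G} (n H) q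
    ... | (a , x) | (b , y) = (Adj G a b × x ≡ y) ⊎ (Adj H x y × a ≡ b)

    PSym : ∀ {p q} → PAdj p q → PAdj q p
    PSym {p} {q} e with remQuot {n G} (n H) p | remQuot {n G} (n H) q
    ... | (a , x) | (b , y) with e
    ... | inj₁ (ab , xy) = inj₁ (symAdj G ab , sym xy)
    ... | inj₂ (xy , ab) = inj₂ (symAdj H xy , sym ab)

    PIrr : ∀ {p} → ¬ PAdj p p
    PIrr {p} e with remQuot {n G} (n H) p
    ... | (a , x) with e
    ... | inj₁ (aa , _) = irrefl G aa
    ... | inj₂ (xx , _) = irrefl H xx

_□_ : Graph → Graph → Graph
G □ H = record { n = n G * n H ; Adj = PAdj G H ; symAdj = PSym G H ; irrefl = PIrr G H }

module Submission where

-- Let f_0,…,f_{t-1} be pairwise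
-- star compatible star edge colourings of G with colours {0,…,k_G-1}, let
-- c : V(H) → {0,…,t-1} be a proper vertex colouring of H (it exists because
-- χ(H) ≤ t), and let h be a star edge colouring of H with s colours.  Colour
-- G □ H with the disjoint palette {0,…,k_G-1} ⊎ {0,…,s-1}: the copy of G in
-- layer x gets f_{c(x)}, and every copy of H gets h.  A bicoloured path or
-- cycle with four edges must alternate between two colours, hence between two
-- edge types; an alternating walk inside one layer or one fibre contradicts
-- that f_i or h is a star colouring, and a walk G,H,G,H meets two adjacent
-- layers x, y at a common G-vertex, contradicting star compatibility of
-- f_{c(x)} and f_{c(y)} (c(x) ≠ c(y)).

open import Defs
open import Data.Nat using (ℕ; _+_; _≤_; _<_; _≤?_)
open import Data.Nat.Properties using (≮⇒≥)
open import Data.Nat.Induction using (<-rec)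
open import Data.Fin using (Fin; remQuot; combine; _↑ˡ_; _↑ʳ_; splitAt; inject≤; _≟_)
open import Data.Fin.Properties
  using (combine-remQuot; splitAt-↑ˡ; splitAt-↑ʳ; ↑ˡ-injective; ↑ʳ-injective; inject≤-injective)
open import Data.Product using (Σ; _×_; _,_; proj₁; uncurry)
open import Data.Sum using (_⊎_; inj₁; inj₂)
open import Data.Empty using (⊥; ⊥-elim)
open import Relation.Nullary using (¬_; yes; no)
open import Relation.Nullary.Negation using (¬¬-map)
open import Relation.Nullary.Decidable using (decidable-stable; ¬¬-excluded-middle)
open import Relation.Binary.PropositionalEquality
  using (_≡_; _≢_; refl; sym; trans; cong; subst)

record Distinct5 {A : Set} (v0 v1 v2 v3 v4 : A) : Set where
  field
    d01 : v0 ≢ v1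
    d02 : v0 ≢ v2
    d03 : v0 ≢ v3
    d12 : v1 ≢ v2
    d13 : v1 ≢ v3
    d23 : v2 ≢ v3
    d41 : v4 ≢ v1
    d42 : v4 ≢ v2
    d43 : v4 ≢ v3

Distinct5-reflect : ∀ {A B : Set} (f : A → B) {v0 v1 v2 v3 v4 : A} →
  Distinct5 (f v0) (f v1) (f v2) (f v3) (f v4) → Distinct5 v0 v1 v2 v3 v4
Distinct5-reflect f d = record
  { d01 = back d01 ; d02 = back d02 ; d03 = back d03 ; d12 = back d12 ; d13 = back d13
  ; d23 = back d23 ; d41 = back d41 ; d42 = back d42 ; d43 = back d43 }
  where
    open Distinct5 d
    back : ∀ {u v} → f u ≢ f v → u ≢ v
    back fu≢fv u≡v = fu≢fv (cong f u≡v)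

Distinct5-map : ∀ {A B : Set} (f : A → B) → (∀ {u v} → f u ≡ f v → u ≡ v) →
  {v0 v1 v2 v3 v4 : A} →
  Distinct5 v0 v1 v2 v3 v4 → Distinct5 (f v0) (f v1) (f v2) (f v3) (f v4)
Distinct5-map f f-injective d = record
  { d01 = forth d01 ; d02 = forth d02 ; d03 = forth d03 ; d12 = forth d12 ; d13 = forth d13
  ; d23 = forth d23 ; d41 = forth d41 ; d42 = forth d42 ; d43 = forth d43 }
  where
    open Distinct5 d
    forth : ∀ {u v} → u ≢ v → f u ≢ f v
    forth u≢v fu≡fv = u≢v (f-injective fu≡fv)

NoAlternatingP4C4 : (G : Graph) {k : ℕ} → EdgeColoring G k → Set
NoAlternatingP4C4 G f =
  ∀ (v0 v1 v2 v3 v4 : Fin (n G)) → Distinct5 v0 v1 v2 v3 v4 →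
  Adj G v0 v1 → Adj G v1 v2 → Adj G v2 v3 → Adj G v3 v4 →
  col f v0 v1 ≡ col f v2 v3 → col f v1 v2 ≡ col f v3 v4 → ⊥

star⇒noAlternating : (G : Graph) {k : ℕ} (f : EdgeColoring G k) →
  IsStarEdgeColoring G f → NoAlternatingP4C4 G f
star⇒noAlternating G f (_ , noBicoloured) v0 v1 v2 v3 v4 d e01 e12 e23 e34 eq13 eq24 =
  noBicoloured v0 v1 v2 v3 v4 d01 d02 d03 d12 d13 d23 d41 d42 d43 e01 e12 e23 e34
    (col f v0 v1 , col f v1 v2 , inj₁ refl , inj₂ refl , inj₁ (sym eq13) , inj₂ (sym eq24))
  where open Distinct5 d

twoColours-alternate : ∀ {k} {α β c1 c2 c3 : Fin k} →
  (c1 ≡ α ⊎ c1 ≡ β) → (c2 ≡ α ⊎ c2 ≡ β) → (c3 ≡ α ⊎ c3 ≡ β) →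
  c1 ≢ c2 → c2 ≢ c3 → c1 ≡ c3
twoColours-alternate (inj₁ p) (inj₁ q) _        c1≢c2 _     = ⊥-elim (c1≢c2 (trans p (sym q)))
twoColours-alternate (inj₁ p) (inj₂ _) (inj₁ r) _     _     = trans p (sym r)
twoColours-alternate (inj₁ _) (inj₂ q) (inj₂ r) _     c2≢c3 = ⊥-elim (c2≢c3 (trans q (sym r)))
twoColours-alternate (inj₂ _) (inj₁ q) (inj₁ r) _     c2≢c3 = ⊥-elim (c2≢c3 (trans q (sym r)))
twoColours-alternate (inj₂ p) (inj₁ _) (inj₂ r) _     _     = trans p (sym r)
twoColours-alternate (inj₂ p) (inj₂ q) _        c1≢c2 _     = ⊥-elim (c1≢c2 (trans p (sym q)))

proper-consecutive : (G : Graph) {k : ℕ} (f : EdgeColoring G k) → Proper G f →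
  ∀ {u v w} → Adj G u v → Adj G v w → u ≢ w → col f u v ≢ col f v w
proper-consecutive G f proper uv vw u≢w eq =
  proper (symAdj G uv) vw u≢w (trans (sym (colSym f uv)) eq)

-- For proper colourings, a bicoloured P4/C4 alternates; hence excluding
-- alternating ones suffices for a star colouring.
noAlternating⇒star : (G : Graph) {k : ℕ} (f : EdgeColoring G k) →
  Proper G f → NoAlternatingP4C4 G f → IsStarEdgeColoring G f
noAlternating⇒star G f proper noAlternating =
  proper , λ where
    v0 v1 v2 v3 v4 d01 d02 d03 d12 d13 d23 d41 d42 d43 e01 e12 e23 e34 (_ , _ , m1 , m2 , m3 , m4) →
      noAlternating v0 v1 v2 v3 v4
        (record { d01 = d01 ; d02 = d02 ; d03 = d03 ; d12 = d12 ; d13 = d13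
                ; d23 = d23 ; d41 = d41 ; d42 = d42 ; d43 = d43 })
        e01 e12 e23 e34
        (twoColours-alternate m1 m2 m3 (distinct e01 e12 d02) (distinct e12 e23 d13))
        (twoColours-alternate m2 m3 m4 (distinct e12 e23 d13) (distinct e23 e34 (λ e → d42 (sym e))))
  where
    distinct : ∀ {u v w} → Adj G u v → Adj G v w → u ≢ w → col f u v ≢ col f v w
    distinct = proper-consecutive G f proper

module ProductColouring (G H : Graph) {kG tG sH : ℕ}
  (F : Fin tG → EdgeColoring G kG) (F-star : ∀ i → IsStarEdgeColoring G (F i))
  (F-compatible : ∀ i j → i ≢ j → StarCompatible G (F i) (F j))
  (c : Fin (n H) → Fin tG) (c-proper : ∀ {x y} → Adj H x y → c x ≢ c y)
  (h : EdgeColoring H sH) (h-star : IsStarEdgeColoring H h) where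

  Colour : Set
  Colour = Fin (kG + sH)

  gColour : Fin kG → Colour
  gColour i = i ↑ˡ sH

  hColour : Fin sH → Colour
  hColour j = kG ↑ʳ j

  gColour-injective : ∀ {i j} → gColour i ≡ gColour j → i ≡ j
  gColour-injective = ↑ˡ-injective sH _ _

  hColour-injective : ∀ {i j} → hColour i ≡ hColour j → i ≡ j
  hColour-injective = ↑ʳ-injective kG _ _

  gColour≢hColour : ∀ {i j} → gColour i ≢ hColour j
  gColour≢hColour {i} {j} eq
    with () ← trans (sym (splitAt-↑ˡ kG i sH)) (trans (cong (splitAt kG) eq) (splitAt-↑ʳ kG sH j))

  Vertex : Set
  Vertex = Fin (n G) × Fin (n H)

  coords : Fin (n (G □ H)) → Vertex
  coords p = remQuot {n G} (n H) p

  coords-injective : ∀ {p q} → coords p ≡ coords q → p ≡ q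
  coords-injective {p} {q} eq =
    trans (sym (combine-remQuot {n G} (n H) p))
          (trans (cong (uncurry combine) eq) (combine-remQuot {n G} (n H) q))

  data Edge : Vertex → Vertex → Set where
    gEdge : ∀ {a b x} → Adj G a b → Edge (a , x) (b , x)
    hEdge : ∀ {a x y} → Adj H x y → Edge (a , x) (a , y)

  CoordAdj : Vertex → Vertex → Set
  CoordAdj (a , x) (b , y) = (Adj G a b × x ≡ y) ⊎ (Adj H x y × a ≡ b)

  adj-coords : ∀ p q → Adj (G □ H) p q → CoordAdj (coords p) (coords q)
  adj-coords p q e with remQuot {n G} (n H) p | remQuot {n G} (n H) q
  ... | (a , x) | (b , y) = e

  classify : ∀ {u v} → CoordAdj u v → Edge u v
  classify {_ , _} {_ , _} (inj₁ (ab , refl)) = gEdge ab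
  classify {_ , _} {_ , _} (inj₂ (xy , refl)) = hEdge xy

  edge : ∀ p q → Adj (G □ H) p q → Edge (coords p) (coords q)
  edge p q e = classify (adj-coords p q e)

  edge-sym : ∀ {u v} → Edge u v → Edge v u
  edge-sym (gEdge ab) = gEdge (symAdj G ab)
  edge-sym (hEdge xy) = hEdge (symAdj H xy)

  edgeColour : ∀ {u v} → Edge u v → Colour
  edgeColour (gEdge {a} {b} {x} _) = gColour (col (F (c x)) a b)
  edgeColour (hEdge {_} {x} {y} _) = hColour (col h x y)

  edgeColour-sym : ∀ {u v} (e : Edge u v) → edgeColour (edge-sym e) ≡ edgeColour e
  edgeColour-sym (gEdge {x = x} ab) = cong gColour (sym (colSym (F (c x)) ab))
  edgeColour-sym (hEdge xy) = cong hColour (sym (colSym h xy))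

  colourAt : Vertex → Vertex → Colour
  colourAt (a , x) (b , y) with x ≟ y
  ... | yes _ = gColour (col (F (c x)) a b)
  ... | no _  = hColour (col h x y)

  -- On edges it agrees with the intended colour (an H-edge never has x ≡ y).
  colourAt-edge : ∀ {u v} (e : Edge u v) → colourAt u v ≡ edgeColour e
  colourAt-edge (gEdge {x = x} _) with x ≟ x
  ... | yes _   = refl
  ... | no x≢x  = ⊥-elim (x≢x refl)
  colourAt-edge (hEdge {_} {x} {y} xy) with x ≟ y
  ... | yes refl = ⊥-elim (irrefl H xy)
  ... | no _     = refl

  colouring : EdgeColoring (G □ H) (kG + sH)
  colouring = record
    { col    = λ p q → colourAt (coords p) (coords q)
    ; colSym = λ {p} {q} pq →
        let e = edge p q pq in
        trans (colourAt-edge e)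
          (trans (sym (edgeColour-sym e)) (sym (colourAt-edge (edge-sym e))))
    }

  -- Properness: edges at a common vertex with distinct other ends differ in
  -- colour — inside a layer or fibre by properness of f_i or h, otherwise
  -- because the two blocks of the palette are disjoint.
  edgeColour-proper : ∀ {u v w} (e : Edge u v) (e' : Edge u w) → v ≢ w →
    edgeColour e ≢ edgeColour e'
  edgeColour-proper (gEdge {x = x} ab) (gEdge ab') v≢w eq =
    proj₁ (F-star (c x)) ab ab' (λ b≡b' → v≢w (cong (_, x) b≡b')) (gColour-injective eq)
  edgeColour-proper (hEdge {a} xy) (hEdge xy') v≢w eq =
    proj₁ h-star xy xy' (λ y≡y' → v≢w (cong (a ,_) y≡y')) (hColour-injective eq)
  edgeColour-proper (gEdge _) (hEdge _) _ eq = gColour≢hColour eq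
  edgeColour-proper (hEdge _) (gEdge _) _ eq = gColour≢hColour (sym eq)

  -- The key use of star compatibility: G-edges a0 a1 in layer x and a1 a3 in
  -- an H-adjacent layer y meet at a1, and c x ≠ c y, so their colours differ.
  adjacentLayers : ∀ {a0 a1 a3 x y} → Adj G a0 a1 → Adj G a1 a3 → Adj H x y →
    col (F (c x)) a0 a1 ≢ col (F (c y)) a1 a3
  adjacentLayers {a0} {a1} {a3} {x} {y} a0a1 a1a3 xy eq =
    F-compatible (c x) (c y) (c-proper xy) a1 a0 a3 (symAdj G a0a1) a1a3
      (trans (sym (colSym (F (c x)) a0a1)) eq)

  -- Equal colours force equal edge kinds
  -- (disjoint blocks), so the walk lies in one layer (f_{c x} is star), in
  -- one fibre (h is star), or alternates G,H,G,H (adjacentLayers).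
  edgeColour-noAlternating : ∀ {u0 u1 u2 u3 u4} → Distinct5 u0 u1 u2 u3 u4 →
    (e01 : Edge u0 u1) (e12 : Edge u1 u2) (e23 : Edge u2 u3) (e34 : Edge u3 u4) →
    edgeColour e01 ≡ edgeColour e23 → edgeColour e12 ≡ edgeColour e34 → ⊥
  edgeColour-noAlternating d (gEdge {x = x} g01) (gEdge g12) (gEdge g23) (gEdge g34) eq13 eq24 =
    star⇒noAlternating G (F (c x)) (F-star (c x)) _ _ _ _ _ (Distinct5-reflect (_, x) d)
      g01 g12 g23 g34 (gColour-injective eq13) (gColour-injective eq24)
  edgeColour-noAlternating d (hEdge {a} h01) (hEdge h12) (hEdge h23) (hEdge h34) eq13 eq24 =
    star⇒noAlternating H h h-star _ _ _ _ _ (Distinct5-reflect (a ,_) d)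
      h01 h12 h23 h34 (hColour-injective eq13) (hColour-injective eq24)
  edgeColour-noAlternating _ (gEdge g01) (hEdge h12) (gEdge g23) (hEdge _) eq13 _ =
    adjacentLayers g01 g23 h12 (gColour-injective eq13)
  edgeColour-noAlternating _ (hEdge _) (gEdge g12) (hEdge h23) (gEdge g34) _ eq24 =
    adjacentLayers g12 g34 h23 (gColour-injective eq24)
  edgeColour-noAlternating _ (gEdge _) _ (hEdge _) _ eq13 _ = gColour≢hColour eq13
  edgeColour-noAlternating _ (hEdge _) _ (gEdge _) _ eq13 _ = gColour≢hColour (sym eq13)
  edgeColour-noAlternating _ _ (gEdge _) _ (hEdge _) _ eq24 = gColour≢hColour eq24
  edgeColour-noAlternating _ _ (hEdge _) _ (gEdge _) _ eq24 = gColour≢hColour (sym eq24)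

  colouring-proper : Proper (G □ H) colouring
  colouring-proper {p} {q} {r} pq pr q≢r eq =
    edgeColour-proper (edge p q pq) (edge p r pr) (λ e → q≢r (coords-injective e))
      (trans (sym (colourAt-edge (edge p q pq))) (trans eq (colourAt-edge (edge p r pr))))

  colouring-noAlternating : NoAlternatingP4C4 (G □ H) colouring
  colouring-noAlternating p0 p1 p2 p3 p4 d p01 p12 p23 p34 eq13 eq24 =
    edgeColour-noAlternating (Distinct5-map coords coords-injective d) e01 e12 e23 e34
      (trans (sym (colourAt-edge e01)) (trans eq13 (colourAt-edge e23)))
      (trans (sym (colourAt-edge e12)) (trans eq24 (colourAt-edge e34)))
    where
      e01 : Edge (coords p0) (coords p1)
      e01 = edge p0 p1 p01
      e12 : Edge (coords p1) (coords p2)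
      e12 = edge p1 p2 p12
      e23 : Edge (coords p2) (coords p3)
      e23 = edge p2 p3 p23
      e34 : Edge (coords p3) (coords p4)
      e34 = edge p3 p4 p34

  colouring-star : IsStarEdgeColoring (G □ H) colouring
  colouring-star =
    noAlternating⇒star (G □ H) colouring colouring-proper colouring-noAlternating

¬¬-least : (P : ℕ → Set) (N : ℕ) → P N →
  ¬ ¬ (Σ ℕ λ m → P m × (∀ m' → P m' → m ≤ m'))
¬¬-least P = <-rec (λ N → P N → ¬ ¬ Least) step
  where
    Least : Set
    Least = Σ ℕ λ m → P m × (∀ m' → P m' → m ≤ m')

    step : ∀ N → (∀ {m} → m < N → P m → ¬ ¬ Least) → P N → ¬ ¬ Least
    step N below pN noLeast = ¬¬-excluded-middle {A = Σ ℕ λ m → m < N × P m} λ where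
      (yes (m , m<N , pm)) → below m<N pm noLeast
      (no none) → noLeast (N , pN , λ m pm → ≮⇒≥ (λ m<N → none (m , m<N , pm)))

¬¬-chromaticNumber : (H : Graph) → ¬ ¬ (Σ ℕ (IsChromaticNumber H))
¬¬-chromaticNumber H = ¬¬-least (VertexColorable H) (n H) identityColouring
  where
    identityColouring : VertexColorable H (n H)
    identityColouring = (λ v → v) , λ {u} uv u≡v → irrefl H (subst (Adj H u) (sym u≡v) uv)

VertexColorable-mono : (H : Graph) {m t : ℕ} → m ≤ t → VertexColorable H m → VertexColorable H t
VertexColorable-mono H m≤t (c , c-proper) =
  (λ v → inject≤ (c v) m≤t) ,
  λ uv eq → c-proper uv (inject≤-injective m≤t m≤t _ _ eq)

theorem2 : (G H : Graph) (kG tG : ℕ) → KTStarColorable G kG tG →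
    (∀ χH → IsChromaticNumber H χH → χH ≤ tG) →
    ∀ sH → IsStarChromaticIndex H sH →
    ∀ sGH → IsStarChromaticIndex (G □ H) sGH → sGH ≤ kG + sH
theorem2 G H kG tG (F , F-star , F-compatible) χH≤tG sH ((h , h-star) , _) sGH (_ , sGH-least) =
  decidable-stable (sGH ≤? kG + sH) (¬¬-map bound (¬¬-chromaticNumber H))
  where
    bound : Σ ℕ (IsChromaticNumber H) → sGH ≤ kG + sH
    bound (χH , isχH@(colouringH , _)) =
      let (c , c-proper) = VertexColorable-mono H (χH≤tG χH isχH) colouringH
          open ProductColouring G H F F-star F-compatible c c-proper h h-star
      in sGH-least (kG + sH) (colouring , colouring-star)
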